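{- Let $d\ge2$ and $m\ge1$, let $X\subseteq\mathbb{Z}^m$ be $d$-automatic, and for each $i=1,\ldots,m$ let $(\ell_{i1},\ldots,\ell_{in_i})$ be a tuple of elements of $\Sigma_\pm$. Then the relation $$\Big\{(k_{ij})\in\mathbb{N}^{n_1}\times\cdots\times\mathbb{N}^{n_m}:\big([\ell_{11}^{k_{11}}\cdots\ell_{1n_1}^{k_{1n_1}}],\ldots,[\ell_{m1}^{k_{m1}}\cdots\ell_{mn_m}^{k_{mn_m}}]\big)\in X\Big\}$$ is definable in $(\mathbb{N},+)$.
   Context: $\mathbb{N}=\{0,1,\ldots\}$, $\Sigma_\pm=\{ -d+1,\ldots,d-1\}$. $\ell^k$ denotes the word consisting of the letter $\ell$ repeated $k$ times; juxtaposition is concatenation. For a string $k_0\cdots k_r$ of integers $[k_0\cdots k_r]=\sum_ik_id^i$; for strings of elements of $\mathbb{Z}^m$ the same formula is used coordinatewise. $X\subseteq\mathbb{Z}^m$ is $d$-automatic if $\{\sigma\in(\Sigma_\pm^m)^*:[\sigma]\in X\}$ is a regular language over $\Sigma_\pm^m$. -}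

module Defs where

open import Data.Nat as ℕ using (ℕ; zero; suc)
open import Data.Integer as ℤ using (ℤ; ∣_∣)
open import Data.Fin using (Fin; zero; suc)
open import Data.Vec using (Vec; []; _∷_; lookup; tabulate)
open import Data.List using (List; []; _∷_; _++_; replicate; map)
open import Data.Product using (Σ; _,_; proj₁; ∃)
open import Data.Maybe using (Maybe; just; nothing)
open import Data.Empty using (⊥)
open import Data.Bool using (Bool; true)
open import Data.Product using (_×_)
open import Data.Sum using (_⊎_)
open import Relation.Binary.PropositionalEquality using (_≡_)
open import Function.Bundles using (_⇔_)

Digit : ℕ → Set
Digit d = Σ ℤ (λ z → ∣ z ∣ ℕ.< d)

-- [k₀⋯k_r] = Σ kᵢ dⁱ  (first letter least significant)
val : (d : ℕ) → List (Digit d) → ℤ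
val d [] = ℤ.0ℤ
val d (k ∷ w) = proj₁ k ℤ.+ (ℤ.+ d) ℤ.* val d w

valVec : (d m : ℕ) → List (Vec (Digit d) m) → Vec ℤ m
valVec d m σ = tabulate (λ i → val d (map (λ v → lookup v i) σ))

record DFA (A : Set) : Set where
  field
    nStates : ℕ
    start   : Fin nStates
    step    : Fin nStates → A → Fin nStates
    final   : Fin nStates → Bool

run : {A : Set} (M : DFA A) → Fin (DFA.nStates M) → List A → Fin (DFA.nStates M)
run M q [] = q
run M q (a ∷ w) = run M (DFA.step M q a) w

Accepts : {A : Set} → DFA A → List A → Set
Accepts M w = DFA.final M (run M (DFA.start M) w) ≡ true

Regular : {A : Set} → (List A → Set) → Set
Regular {A} L = Σ (DFA A) (λ M → ∀ w → L w ⇔ Accepts M w)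

Automatic : (d m : ℕ) → (Vec ℤ m → Set) → Set
Automatic d m X = Regular (λ (σ : List (Vec (Digit d) m)) → X (valVec d m σ))

data Term (V : Set) : Set where
  var  : V → Term V
  _⊕_  : Term V → Term V → Term V

data Formula (V : Set) : Set where
  _≐_   : Term V → Term V → Formula V
  ¬'_   : Formula V → Formula V
  _∧'_  : Formula V → Formula V → Formula V
  _∨'_  : Formula V → Formula V → Formula V
  ∃'_   : Formula (Maybe V) → Formula V
  ∀'_   : Formula (Maybe V) → Formula V

⟦_⟧t : {V : Set} → Term V → (V → ℕ) → ℕ
⟦ var x ⟧t ρ = ρ x
⟦ s ⊕ t ⟧t ρ = ⟦ s ⟧t ρ ℕ.+ ⟦ t ⟧t ρ

extend : {V : Set} → (V → ℕ) → ℕ → Maybe V → ℕ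
extend ρ n nothing = n
extend ρ n (just x) = ρ x

⟦_⟧ : {V : Set} → Formula V → (V → ℕ) → Set
⟦ s ≐ t ⟧ ρ = ⟦ s ⟧t ρ ≡ ⟦ t ⟧t ρ
⟦ ¬' φ ⟧ ρ = ⟦ φ ⟧ ρ → ⊥
⟦ φ ∧' ψ ⟧ ρ = ⟦ φ ⟧ ρ × ⟦ ψ ⟧ ρ
⟦ φ ∨' ψ ⟧ ρ = ⟦ φ ⟧ ρ ⊎ ⟦ ψ ⟧ ρ
⟦ ∃' φ ⟧ ρ = Σ ℕ (λ n → ⟦ φ ⟧ (extend ρ n))
⟦ ∀' φ ⟧ ρ = (n : ℕ) → ⟦ φ ⟧ (extend ρ n)

PresburgerDefinable : (V : Set) → ((V → ℕ) → Set) → Set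
PresburgerDefinable V R = Σ (Formula V) (λ φ → ∀ ρ → R ρ ⇔ ⟦ φ ⟧ ρ)

block : {A : Set} {n : ℕ} → Vec A n → (Fin n → ℕ) → List A
block [] k = []
block (l ∷ ls) k = replicate (k zero) l ++ block ls (λ j → k (suc j))

module Submission where

open import Defs
open import Data.Nat using (ℕ; _≤_)
open import Data.Integer using (ℤ)
open import Data.Fin using (Fin)
open import Data.Vec using (Vec; tabulate)
open import Data.Product using (Σ; _,_)

open import Data.Nat as ℕ using (zero; suc; _+_; _*_; _∸_; _<_; z≤n; s≤s; _≤?_; _<?_; NonZero)
import Data.Nat.Properties as ℕₚ
open import Data.Nat.DivMod using (_%_; _/_; m≡m%n+[m/n]*n; m%n<n)
open import Data.Nat.Tactic.RingSolver using (solve-∀)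
import Data.Integer as ℤ
import Data.Integer.Properties as ℤₚ
open import Data.Fin using (zero; suc; toℕ; fromℕ<)
import Data.Fin.Properties as Finₚ
open import Data.Vec using ([]; _∷_; lookup)
open import Data.Vec.Properties using (tabulate-cong; lookup∘tabulate)
open import Data.Vec.Functional using (updateAt)
open import Data.Vec.Functional.Properties using (updateAt-updates; updateAt-minimal)
open import Data.List using (List; []; _∷_; _++_; replicate; length; map; drop)
import Data.List.Properties as Listₚ
open import Data.Bool using (true; if_then_else_)
import Data.Bool.Properties as Boolₚ
open import Data.Maybe using (Maybe; just; nothing)
open import Data.Product using (proj₁; proj₂; _×_)
open import Data.Product.Function.NonDependent.Propositional using (_×-⇔_)
open import Data.Sum using (_⊎_; inj₁; inj₂)
open import Data.Sum.Function.Propositional using (_⊎-⇔_)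
open import Data.Empty using (⊥)
open import Data.Unit using (⊤; tt)
open import Relation.Nullary using (Dec; yes; no; does; ¬_; contradiction)
open import Relation.Nullary.Decidable using (dec-true; dec-false)
open import Relation.Binary.PropositionalEquality using (_≡_; refl; sym; trans; cong; cong₂; subst; module ≡-Reasoning)
open import Function.Bundles using (_⇔_; mk⇔; Equivalence)
import Function.Properties.Equivalence as ⇔
open import Function.Related.TypeIsomorphisms using (¬-cong-⇔)

open Equivalence using (to; from)

-- Write the m words ℓ_i1^{k_i1} ⋯ on m parallel tracks and pad them with zero digits up to a
-- common length u; the value vector of the resulting word over Σ±^m is the target vector, so the
-- relation holds iff a DFA M recognising X accepts that word.  A track is a list of blocks
-- (letter, end position) whose end positions are sums of the variables.  Up to the earliest block
-- end the word is constant, and the state reached by reading a^t is an eventually periodic function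
-- of t (pigeonhole on the states of M); eventually periodic sets are finite unions of arithmetic
-- progressions, hence definable.  Cutting the word at the earliest block end and recursing on the
-- number of blocks expresses acceptance as a finite combination of such conditions and of linear
-- inequalities between block ends.

Definable : (V : Set) → ((V → ℕ) → Set) → Set
Definable = PresburgerDefinable

module _ {V : Set} where

  definable-⇔ : {R R' : (V → ℕ) → Set} → (∀ ρ → R ρ ⇔ R' ρ) → Definable V R' → Definable V R
  definable-⇔ R⇔R' (φ , R'⇔φ) = φ , λ ρ → ⇔.trans (R⇔R' ρ) (R'⇔φ ρ)

  definable-≐ : (s t : Term V) → Definable V (λ ρ → ⟦ s ⟧t ρ ≡ ⟦ t ⟧t ρ)
  definable-≐ s t = (s ≐ t) , λ ρ → ⇔.refl

  definable-¬ : {R : (V → ℕ) → Set} → Definable V R → Definable V (λ ρ → ¬ R ρ)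
  definable-¬ (φ , R⇔φ) = (¬' φ) , λ ρ → ¬-cong-⇔ (R⇔φ ρ)

  definable-× : {R R' : (V → ℕ) → Set} → Definable V R → Definable V R' → Definable V (λ ρ → R ρ × R' ρ)
  definable-× (φ , R⇔φ) (ψ , R'⇔ψ) = (φ ∧' ψ) , λ ρ → R⇔φ ρ ×-⇔ R'⇔ψ ρ

  definable-⊎ : {R R' : (V → ℕ) → Set} → Definable V R → Definable V R' → Definable V (λ ρ → R ρ ⊎ R' ρ)
  definable-⊎ (φ , R⇔φ) (ψ , R'⇔ψ) = (φ ∨' ψ) , λ ρ → R⇔φ ρ ⊎-⇔ R'⇔ψ ρ

  definable-∃ : {R : (Maybe V → ℕ) → Set} → Definable (Maybe V) R → Definable V (λ ρ → Σ ℕ λ n → R (extend ρ n))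
  definable-∃ (φ , R⇔φ) = (∃' φ) , λ ρ → mk⇔ (λ (n , r) → n , to (R⇔φ _) r) (λ (n , r) → n , from (R⇔φ _) r)

  definable-∀ : {R : (Maybe V → ℕ) → Set} → Definable (Maybe V) R → Definable V (λ ρ → ∀ n → R (extend ρ n))
  definable-∀ (φ , R⇔φ) = (∀' φ) , λ ρ → mk⇔ (λ r n → to (R⇔φ _) (r n)) (λ r n → from (R⇔φ _) (r n))

module _ {V : Set} where

  definable-⊤ : Definable V (λ _ → ⊤)
  definable-⊤ = definable-⇔ (λ ρ → mk⇔ (λ _ n → refl) (λ _ → tt)) (definable-∀ (definable-≐ (var nothing) (var nothing)))

  definable-⊥ : Definable V (λ _ → ⊥)
  definable-⊥ = definable-⇔ (λ ρ → mk⇔ (λ ()) (λ ¬⊤ → ¬⊤ tt)) (definable-¬ definable-⊤)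

  definable-dec : {P : Set} {R : (V → ℕ) → Set} → Dec P → Definable V R → Definable V (λ ρ → P × R ρ)
  definable-dec (yes p) R = definable-⇔ (λ ρ → mk⇔ proj₂ (p ,_)) R
  definable-dec (no ¬p) R = definable-⇔ (λ ρ → mk⇔ (λ (p , _) → ¬p p) λ ()) definable-⊥

  definable-any : (k : ℕ) {R : Fin k → (V → ℕ) → Set} → (∀ i → Definable V (R i))
                → Definable V (λ ρ → Σ (Fin k) λ i → R i ρ)
  definable-any zero R = definable-⇔ (λ ρ → mk⇔ (λ ()) λ ()) definable-⊥
  definable-any (suc k) R = definable-⇔
    (λ ρ → mk⇔ (λ { (zero , r) → inj₁ r ; (suc i , r) → inj₂ (i , r) })
               (λ { (inj₁ r) → zero , r ; (inj₂ (i , r)) → suc i , r }))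
    (definable-⊎ (R zero) (definable-any k (λ i → R (suc i))))

  definable-all : (k : ℕ) {R : Fin k → (V → ℕ) → Set} → (∀ i → Definable V (R i))
                → Definable V (λ ρ → ∀ i → R i ρ)
  definable-all zero R = definable-⇔ (λ ρ → mk⇔ (λ _ → tt) (λ _ ())) definable-⊤
  definable-all (suc k) R = definable-⇔
    (λ ρ → mk⇔ (λ r → r zero , λ i → r (suc i))
               (λ { (r , rs) zero → r ; (r , rs) (suc i) → rs i }))
    (definable-× (R zero) (definable-all k (λ i → R (suc i))))

wk : {V : Set} → Term V → Term (Maybe V)
wk (var x) = var (just x)
wk (s ⊕ t) = wk s ⊕ wk t

wk-sem : {V : Set} (t : Term V) (ρ : V → ℕ) (n : ℕ) → ⟦ wk t ⟧t (extend ρ n) ≡ ⟦ t ⟧t ρ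
wk-sem (var x) ρ n = refl
wk-sem (s ⊕ t) ρ n = cong₂ _+_ (wk-sem s ρ n) (wk-sem t ρ n)

≤⇔∃+ : {m n : ℕ} → m ≤ n ⇔ Σ ℕ λ t → m + t ≡ n
≤⇔∃+ {m} = mk⇔ (λ m≤n → _ , ℕₚ.m+[n∸m]≡n m≤n) (λ (t , m+t≡n) → subst (m ≤_) m+t≡n (ℕₚ.m≤m+n m t))

n+n≡n⇔n≡0 : {n : ℕ} → n + n ≡ n ⇔ n ≡ 0
n+n≡n⇔n≡0 {n} = mk⇔ (λ e → ℕₚ.+-cancelˡ-≡ n n 0 (trans e (sym (ℕₚ.+-identityʳ n)))) (λ { refl → refl })

∸⇔ : {t m n : ℕ} → t ≡ m ∸ n ⇔ (n + t ≡ m ⊎ (m ≤ n × t ≡ 0))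
∸⇔ {t} {m} {n} = mk⇔ fw bw
  where
  fw : t ≡ m ∸ n → n + t ≡ m ⊎ (m ≤ n × t ≡ 0)
  fw refl with n ≤? m
  ... | yes n≤m = inj₁ (ℕₚ.m+[n∸m]≡n n≤m)
  ... | no n≰m  = let m≤n = ℕₚ.<⇒≤ (ℕₚ.≰⇒> n≰m) in inj₂ (m≤n , ℕₚ.m≤n⇒m∸n≡0 m≤n)
  bw : n + t ≡ m ⊎ (m ≤ n × t ≡ 0) → t ≡ m ∸ n
  bw (inj₁ refl) = sym (ℕₚ.m+n∸m≡n n t)
  bw (inj₂ (m≤n , refl)) = sym (ℕₚ.m≤n⇒m∸n≡0 m≤n)

wk-sem₂ : {V : Set} (P : ℕ → ℕ → Set) (s t : Term V) (ρ : V → ℕ) (n : ℕ)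
        → P (⟦ wk s ⟧t (extend ρ n)) (⟦ wk t ⟧t (extend ρ n)) ⇔ P (⟦ s ⟧t ρ) (⟦ t ⟧t ρ)
wk-sem₂ P s t ρ n rewrite wk-sem s ρ n | wk-sem t ρ n = ⇔.refl

Σ-⇔ : {A B : ℕ → Set} → (∀ n → A n ⇔ B n) → (Σ ℕ A) ⇔ (Σ ℕ B)
Σ-⇔ A⇔B = mk⇔ (λ (n , a) → n , to (A⇔B n) a) (λ (n , b) → n , from (A⇔B n) b)

one-point : {X : Set} {P : X → Set} {v : X} → P v ⇔ (Σ X λ x → x ≡ v × P x)
one-point = mk⇔ (λ p → _ , refl , p) (λ { (n , refl , p) → p })

module _ {V : Set} where

  definable-≤ : (s t : Term V) → Definable V (λ ρ → ⟦ s ⟧t ρ ≤ ⟦ t ⟧t ρ)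
  definable-≤ s t = definable-⇔ (λ ρ → ⇔.trans ≤⇔∃+ (Σ-⇔ λ n → ⇔.sym (wk-sem₂ (λ a b → a + n ≡ b) s t ρ n)))
                                (definable-∃ (definable-≐ (wk s ⊕ var nothing) (wk t)))

  definable-zero : (x : V) → Definable V (λ ρ → ρ x ≡ 0)
  definable-zero x = definable-⇔ (λ ρ → ⇔.sym n+n≡n⇔n≡0) (definable-≐ (var x ⊕ var x) (var x))

module _ {V : Set} where

  definable-at-∸ : (x y : Term V) {R : (Maybe V → ℕ) → Set} → Definable (Maybe V) R
                 → Definable V (λ ρ → R (extend ρ (⟦ x ⟧t ρ ∸ ⟦ y ⟧t ρ)))
  definable-at-∸ x y R = definable-⇔
    (λ ρ → ⇔.trans one-point (Σ-⇔ λ t → ⇔.sym (difference ρ t) ×-⇔ ⇔.refl))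
    (definable-∃ (definable-× (definable-⊎ (definable-≐ (wk y ⊕ var nothing) (wk x))
                                           (definable-× (definable-≤ (wk x) (wk y)) (definable-zero nothing)))
                              R))
    where
    difference : ∀ ρ t → ((⟦ wk y ⟧t (extend ρ t) + t ≡ ⟦ wk x ⟧t (extend ρ t))
                          ⊎ (⟦ wk x ⟧t (extend ρ t) ≤ ⟦ wk y ⟧t (extend ρ t) × t ≡ 0))
                         ⇔ (t ≡ ⟦ x ⟧t ρ ∸ ⟦ y ⟧t ρ)
    difference ρ t = ⇔.trans (wk-sem₂ (λ a b → b + t ≡ a ⊎ (a ≤ b × t ≡ 0)) x y ρ t) (⇔.sym ∸⇔)

1-indecomposable : ∀ a b → a + b ≡ 1 → a ≡ 0 ⊎ b ≡ 0
1-indecomposable zero b _ = inj₁ refl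
1-indecomposable (suc a) zero _ = inj₂ refl
1-indecomposable (suc a) (suc b) e = contradiction (trans (sym (ℕₚ.+-suc a b)) (ℕₚ.suc-injective e)) λ ()

≡1⇔ : ∀ n → n ≡ 1 ⇔ (¬ n ≡ 0 × ∀ a b → ¬ (a + b ≡ n × ¬ (a ≡ 0 ⊎ b ≡ 0)))
≡1⇔ n = mk⇔ (λ { refl → (λ ()) , λ a b (e , neither) → neither (1-indecomposable a b e) }) (bw n)
  where
  bw : ∀ n → ¬ n ≡ 0 × (∀ a b → ¬ (a + b ≡ n × ¬ (a ≡ 0 ⊎ b ≡ 0))) → n ≡ 1
  bw zero (n≢0 , _) = contradiction refl n≢0
  bw (suc k) (_ , indecomposable) with k ℕ.≟ 0
  ... | yes k≡0 = cong suc k≡0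
  ... | no k≢0 = contradiction (refl , λ { (inj₁ ()) ; (inj₂ k≡0) → k≢0 k≡0 }) (indecomposable 1 k)

module _ {V : Set} where

  definable-one : (x : V) → Definable V (λ ρ → ρ x ≡ 1)
  definable-one x = definable-⇔ (λ ρ → ≡1⇔ (ρ x))
    (definable-× (definable-¬ (definable-zero x))
                 (definable-∀ (definable-∀ (definable-¬ (definable-×
                    (definable-≐ (var (just nothing) ⊕ var nothing) (var (just (just x))))
                    (definable-¬ (definable-⊎ (definable-zero (just nothing)) (definable-zero nothing))))))))

definable-multiple : {V : Set} (p : ℕ) (c y : V) → Definable V (λ ρ → ρ y ≡ p * ρ c)
definable-multiple zero c y = definable-zero y
definable-multiple (suc p) c y = definable-⇔ (λ ρ → one-point)
  (definable-∃ (definable-× (definable-multiple p (just c) nothing)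
                            (definable-≐ (var (just y)) (var (just c) ⊕ var nothing))))

-- x lies in the arithmetic progression a + p ℕ (a singleton when p = 0).
definable-progression : {V : Set} (a p : ℕ) (x : V) → Definable V (λ ρ → Σ ℕ λ c → ρ x ≡ a + p * c)
definable-progression a p x = definable-⇔ (λ ρ → Σ-⇔ λ c → unfold (ρ x) c)
  (definable-∃ (definable-∃ (definable-× (definable-one nothing)
    (definable-∃ (definable-× (definable-multiple a (just nothing) nothing)
      (definable-∃ (definable-× (definable-multiple p (just (just (just nothing))) nothing)
        (definable-≐ (var (just (just (just (just x))))) (var (just nothing) ⊕ var nothing)))))))))
  where
  unfold : ∀ n c → n ≡ a + p * c
         ⇔ (Σ ℕ λ o → o ≡ 1 × Σ ℕ λ u → u ≡ a * o × Σ ℕ λ v → v ≡ p * c × n ≡ u + v)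
  unfold n c = ⇔.trans (subst (λ a' → n ≡ a + p * c ⇔ n ≡ a' + p * c) (sym (ℕₚ.*-identityʳ a)) ⇔.refl)
                       (⇔.trans one-point (Σ-⇔ λ o → ⇔.refl ×-⇔ ⇔.trans one-point (Σ-⇔ λ u → ⇔.refl ×-⇔ one-point)))

below-or-progression : (I p : ℕ) .{{_ : NonZero p}} (n : ℕ)
                     → (Σ (Fin I) λ t → n ≡ toℕ t) ⊎ (Σ (Fin p) λ r → Σ ℕ λ c → n ≡ I + toℕ r + p * c)
below-or-progression I p n with n <? I
... | yes n<I = inj₁ (fromℕ< n<I , sym (Finₚ.toℕ-fromℕ< n<I))
... | no n≮I = inj₂ (fromℕ< (m%n<n D p) , D / p , n≡)
  where
  open ≡-Reasoning
  D = n ∸ I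
  n≡ : n ≡ I + toℕ (fromℕ< (m%n<n D p)) + p * (D / p)
  n≡ = begin
    n                           ≡⟨ sym (ℕₚ.m+[n∸m]≡n (ℕₚ.≮⇒≥ n≮I)) ⟩
    I + D                       ≡⟨ cong (I +_) (m≡m%n+[m/n]*n D p) ⟩
    I + (D % p + D / p * p)     ≡⟨ regroup I (D % p) (D / p) p ⟩
    I + D % p + p * (D / p)     ≡⟨ cong (λ r → I + r + p * (D / p)) (sym (Finₚ.toℕ-fromℕ< (m%n<n D p))) ⟩
    I + toℕ (fromℕ< (m%n<n D p)) + p * (D / p) ∎
    where
    regroup : ∀ I r c p → I + (r + c * p) ≡ I + r + p * c
    regroup = solve-∀

definable-eventually-periodic : {V : Set} {P : ℕ → Set} → (∀ n → Dec (P n))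
  → (I p : ℕ) .{{_ : NonZero p}} → (∀ r c → P (I + r + p * c) ⇔ P (I + r))
  → (x : V) → Definable V (λ ρ → P (ρ x))
definable-eventually-periodic {P = P} P? I p periodic x = definable-⇔ (λ ρ → mk⇔ (classify (ρ x)) (declassify (ρ x)))
  (definable-⊎ (definable-any I λ t → definable-dec (P? (toℕ t)) (definable-progression (toℕ t) 0 x))
               (definable-any p λ r → definable-dec (P? (I + toℕ r)) (definable-progression (I + toℕ r) p x)))
  where
  Classified : ℕ → Set
  Classified n = (Σ (Fin I) λ t → P (toℕ t) × Σ ℕ λ c → n ≡ toℕ t + 0 * c)
               ⊎ (Σ (Fin p) λ r → P (I + toℕ r) × Σ ℕ λ c → n ≡ I + toℕ r + p * c)
  classify : ∀ n → P n → Classified n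
  classify n Pn with below-or-progression I p n
  ... | inj₁ (t , n≡t) = inj₁ (t , subst P n≡t Pn , 0 , trans n≡t (sym (ℕₚ.+-identityʳ _)))
  ... | inj₂ (r , c , n≡) = inj₂ (r , to (periodic (toℕ r) c) (subst P n≡ Pn) , c , n≡)
  declassify : ∀ n → Classified n → P n
  declassify n (inj₁ (t , Pt , c , n≡)) = subst P (sym (trans n≡ (ℕₚ.+-identityʳ _))) Pt
  declassify n (inj₂ (r , Pr , c , n≡)) = subst P (sym n≡) (from (periodic (toℕ r) c) Pr)

orbit-eventually-periodic : {N : ℕ} (h : ℕ → Fin N) → (∀ a b → h a ≡ h b → ∀ k → h (a + k) ≡ h (b + k))
                          → Σ ℕ λ I → Σ ℕ λ q → ∀ r c → h (I + r + suc q * c) ≡ h (I + r)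
orbit-eventually-periodic {N} h deterministic = I , q , periodic
  where
  open ≡-Reasoning
  repetition = Finₚ.pigeonhole (ℕₚ.n<1+n N) (λ k → h (toℕ k))
  I = toℕ (proj₁ repetition)
  J = toℕ (proj₁ (proj₂ repetition))
  q = J ∸ suc I
  J≡I+period : J ≡ I + suc q
  J≡I+period = sym (trans (ℕₚ.+-suc I q) (ℕₚ.m+[n∸m]≡n (proj₁ (proj₂ (proj₂ repetition)))))
  hI≡hJ : h I ≡ h J
  hI≡hJ = proj₂ (proj₂ (proj₂ repetition))
  periodic : ∀ r c → h (I + r + suc q * c) ≡ h (I + r)
  periodic r zero = cong h (trans (cong (I + r +_) (ℕₚ.*-zeroʳ q)) (ℕₚ.+-identityʳ _))
  periodic r (suc c) = begin
    h (I + r + suc q * suc c)       ≡⟨ cong h (regroup I r q c) ⟩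
    h ((I + suc q) + (r + suc q * c)) ≡⟨ cong (λ j → h (j + (r + suc q * c))) (sym J≡I+period) ⟩
    h (J + (r + suc q * c))         ≡⟨ sym (deterministic I J hI≡hJ (r + suc q * c)) ⟩
    h (I + (r + suc q * c))         ≡⟨ cong h (sym (ℕₚ.+-assoc I r _)) ⟩
    h (I + r + suc q * c)           ≡⟨ periodic r c ⟩
    h (I + r)                       ∎
    where
    regroup : ∀ I r q c → I + r + suc q * suc c ≡ (I + suc q) + (r + suc q * c)
    regroup = solve-∀

definable-orbit : {V : Set} {N : ℕ} (h : ℕ → Fin N) → (∀ a b → h a ≡ h b → ∀ k → h (a + k) ≡ h (b + k))
                → (Q : Fin N → Set) → (∀ s → Dec (Q s)) → (x : V) → Definable V (λ ρ → Q (h (ρ x)))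
definable-orbit h deterministic Q Q? x with orbit-eventually-periodic h deterministic
... | I , q , periodic = definable-eventually-periodic (λ n → Q? (h n)) I (suc q)
                           (λ r c → subst (λ s → Q s ⇔ Q (h (I + r))) (sym (periodic r c)) ⇔.refl) x

segment : {A : Set} → (ℕ → A) → ℕ → ℕ → List A
segment g s zero = []
segment g s (suc n) = g s ∷ segment g (suc s) n

segment-++ : {A : Set} (g : ℕ → A) (s a b : ℕ) → segment g s (a + b) ≡ segment g s a ++ segment g (s + a) b
segment-++ g s zero b = cong (λ t → segment g t b) (sym (ℕₚ.+-identityʳ s))
segment-++ g s (suc a) b = cong (g s ∷_)
  (trans (segment-++ g (suc s) a b) (cong (λ t → segment g (suc s) a ++ segment g t b) (sym (ℕₚ.+-suc s a))))

segment-cong : {A : Set} (g g' : ℕ → A) (s n : ℕ) → (∀ p → s ≤ p → p < s + n → g p ≡ g' p) → segment g s n ≡ segment g' s n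
segment-cong g g' s zero agree = refl
segment-cong g g' s (suc n) agree =
  cong₂ _∷_ (agree s ℕₚ.≤-refl (ℕₚ.m<m+n s (s≤s z≤n)))
            (segment-cong g g' (suc s) n (λ p s<p p<s+1+n → agree p (ℕₚ.<⇒≤ s<p) (subst (p <_) (sym (ℕₚ.+-suc s n)) p<s+1+n)))

segment-const : {A : Set} (c : A) (s n : ℕ) → segment (λ _ → c) s n ≡ replicate n c
segment-const c s zero = refl
segment-const c s (suc n) = cong (c ∷_) (segment-const c (suc s) n)

segment-map : {A B : Set} (f : A → B) (g : ℕ → A) (s n : ℕ) → map f (segment g s n) ≡ segment (λ p → f (g p)) s n
segment-map f g s zero = refl
segment-map f g s (suc n) = cong (f (g s) ∷_) (segment-map f g (suc s) n)

module _ {A : Set} (M : DFA A) where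
  open DFA M using (nStates; step; final)

  AcceptsFrom : Fin nStates → List A → Set
  AcceptsFrom q w = final (run M q w) ≡ true

  run-++ : ∀ q u v → run M q (u ++ v) ≡ run M (run M q u) v
  run-++ q [] v = refl
  run-++ q (a ∷ u) v = run-++ (step q a) u v

  acceptsFrom-++ : ∀ q u v → AcceptsFrom q (u ++ v) ⇔ AcceptsFrom (run M q u) v
  acceptsFrom-++ q u v = subst (λ r → AcceptsFrom q (u ++ v) ⇔ (final r ≡ true)) (run-++ q u v) ⇔.refl

  -- Reading a constant word a^n is an orbit of the map q ↦ step q a, so equal states have equal futures.
  run-replicate-+ : ∀ q x a k → run M q (replicate (a + k) x) ≡ run M (run M q (replicate a x)) (replicate k x)
  run-replicate-+ q x zero k = refl
  run-replicate-+ q x (suc a) k = run-replicate-+ (step q x) x a k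

  run-replicate-deterministic : ∀ q x a b → run M q (replicate a x) ≡ run M q (replicate b x)
                              → ∀ k → run M q (replicate (a + k) x) ≡ run M q (replicate (b + k) x)
  run-replicate-deterministic q x a b same k = begin
    run M q (replicate (a + k) x)                  ≡⟨ run-replicate-+ q x a k ⟩
    run M (run M q (replicate a x)) (replicate k x) ≡⟨ cong (λ r → run M r (replicate k x)) same ⟩
    run M (run M q (replicate b x)) (replicate k x) ≡⟨ sym (run-replicate-+ q x b k) ⟩
    run M q (replicate (b + k) x)                  ∎
    where open ≡-Reasoning

-- x ≤∞ k: x is at most k, where nothing stands for +∞.
data _≤∞_ (x : ℕ) : Maybe ℕ → Set where
  ≤∞-∞   : x ≤∞ nothing
  ≤∞-fin : ∀ {v} → x ≤ v → x ≤∞ just v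

≤∞-trans : ∀ {x y k} → x ≤ y → y ≤∞ k → x ≤∞ k
≤∞-trans x≤y ≤∞-∞ = ≤∞-∞
≤∞-trans x≤y (≤∞-fin y≤v) = ≤∞-fin (ℕₚ.≤-trans x≤y y≤v)

least-below : (u k : ℕ) (f : Fin k → Maybe ℕ)
            → (∀ i → u ≤∞ f i) ⊎ (Σ (Fin k) λ i₀ → Σ ℕ λ v → f i₀ ≡ just v × v < u × ∀ j → v ≤∞ f j)
least-below u zero f = inj₁ λ ()
least-below u (suc k) f with least-below u k (λ i → f (suc i)) | f zero in f0≡
... | inj₁ rest≥u | nothing = inj₁ λ { zero → subst (u ≤∞_) (sym f0≡) ≤∞-∞ ; (suc i) → rest≥u i }
... | inj₂ (i₀ , v , fi₀≡v , v<u , v≤rest) | nothing =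
      inj₂ (suc i₀ , v , fi₀≡v , v<u , λ { zero → subst (v ≤∞_) (sym f0≡) ≤∞-∞ ; (suc j) → v≤rest j })
... | inj₁ rest≥u | just w with w <? u
...   | yes w<u = inj₂ (zero , w , f0≡ , w<u , λ { zero → subst (w ≤∞_) (sym f0≡) (≤∞-fin ℕₚ.≤-refl)
                                                ; (suc j) → ≤∞-trans (ℕₚ.<⇒≤ w<u) (rest≥u j) })
...   | no w≮u = inj₁ λ { zero → subst (u ≤∞_) (sym f0≡) (≤∞-fin (ℕₚ.≮⇒≥ w≮u)) ; (suc i) → rest≥u i }
least-below u (suc k) f | inj₂ (i₀ , v , fi₀≡v , v<u , v≤rest) | just w with w ≤? v
...   | yes w≤v = inj₂ (zero , w , f0≡ , ℕₚ.≤-<-trans w≤v v<u , λ { zero → subst (w ≤∞_) (sym f0≡) (≤∞-fin ℕₚ.≤-refl)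
                                                                  ; (suc j) → ≤∞-trans w≤v (v≤rest j) })
...   | no w≰v = inj₂ (suc i₀ , v , fi₀≡v , v<u , λ { zero → subst (v ≤∞_) (sym f0≡) (≤∞-fin (ℕₚ.<⇒≤ (ℕₚ.≰⇒> w≰v)))
                                                    ; (suc j) → v≤rest j })

-- The total length of finitely many lists; it is the measure for the induction on blocks.
totalLength : {X : Set} {k : ℕ} → (Fin k → List X) → ℕ
totalLength {k = zero} ls = 0
totalLength {k = suc k} ls = length (ls zero) + totalLength (λ i → ls (suc i))

length≤totalLength : {X : Set} {k : ℕ} (ls : Fin k → List X) (i : Fin k) → length (ls i) ≤ totalLength ls
length≤totalLength ls zero = ℕₚ.m≤m+n _ _
length≤totalLength ls (suc i) = ℕₚ.≤-trans (length≤totalLength (λ j → ls (suc j)) i) (ℕₚ.m≤n+m _ (length (ls zero)))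

totalLength-drop : {X : Set} {k : ℕ} (ls : Fin k → List X) (i₀ : Fin k) {x : X} {xs : List X}
                 → ls i₀ ≡ x ∷ xs → totalLength (updateAt ls i₀ (drop 1)) < totalLength ls
totalLength-drop ls zero li₀≡ rewrite li₀≡ = ℕₚ.≤-refl
totalLength-drop ls (suc i₀) li₀≡ = ℕₚ.+-monoʳ-< (length (ls zero)) (totalLength-drop (λ i → ls (suc i)) i₀ li₀≡)

window-bound : ∀ {s u p} → s ≤ p → p < s + (u ∸ s) → p < u
window-bound {s} {u} {p} s≤p p<w with s ≤? u
... | yes s≤u = subst (p <_) (ℕₚ.m+[n∸m]≡n s≤u) p<w
... | no s≰u = contradiction (subst (p <_) s+[u∸s]≡s p<w) (ℕₚ.≤⇒≯ s≤p)
  where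
  s+[u∸s]≡s : s + (u ∸ s) ≡ s
  s+[u∸s]≡s = trans (cong (s +_) (ℕₚ.m≤n⇒m∸n≡0 (ℕₚ.<⇒≤ (ℕₚ.≰⇒> s≰u)))) (ℕₚ.+-identityʳ s)

∸-split : ∀ {s t u} → s ≤ t → t ≤ u → u ∸ s ≡ (t ∸ s) + (u ∸ t)
∸-split {s} {t} {u} s≤t t≤u = begin
  u ∸ s             ≡⟨ cong (_∸ s) (sym (ℕₚ.m∸n+n≡m t≤u)) ⟩
  (u ∸ t) + t ∸ s   ≡⟨ ℕₚ.+-∸-assoc (u ∸ t) s≤t ⟩
  (u ∸ t) + (t ∸ s) ≡⟨ ℕₚ.+-comm (u ∸ t) (t ∸ s) ⟩
  (t ∸ s) + (u ∸ t) ∎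
  where open ≡-Reasoning

module Layouts {A : Set} (blank : A) {m : ℕ} (M : DFA (Vec A m)) (V : Set) where
  open DFA M using (nStates; final)

  -- A block is a letter with the symbolic position at which it ends; a track is a list of blocks,
  -- and a layout of m tracks describes a word over Vec A m.
  Block : Set
  Block = A × Term V

  Track : Set
  Track = List Block

  Layout : Set
  Layout = Fin m → Track

  letterAt : (V → ℕ) → Track → ℕ → A
  letterAt ρ [] p = blank
  letterAt ρ ((a , e) ∷ bs) p = if does (p <? ⟦ e ⟧t ρ) then a else letterAt ρ bs p

  letters : (V → ℕ) → Layout → ℕ → Vec A m
  letters ρ L p = tabulate (λ i → letterAt ρ (L i) p)

  word : (V → ℕ) → Layout → ℕ → ℕ → List (Vec A m)
  word ρ L s u = segment (letters ρ L) s (u ∸ s)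

  firstLetter : Track → A
  firstLetter [] = blank
  firstLetter ((a , _) ∷ _) = a

  heads : Layout → Vec A m
  heads L = tabulate (λ i → firstLetter (L i))

  firstEnd : (V → ℕ) → Track → Maybe ℕ
  firstEnd ρ [] = nothing
  firstEnd ρ ((_ , e) ∷ _) = just (⟦ e ⟧t ρ)

  dropFirst : Fin m → Layout → Layout
  dropFirst i₀ L = updateAt L i₀ (drop 1)

  letterAt-first : ∀ ρ t {x p} → x ≤∞ firstEnd ρ t → p < x → letterAt ρ t p ≡ firstLetter t
  letterAt-first ρ [] _ _ = refl
  letterAt-first ρ ((a , e) ∷ bs) {p = p} (≤∞-fin x≤e) p<x =
    cong (if_then a else letterAt ρ bs p) (dec-true (p <? ⟦ e ⟧t ρ) (ℕₚ.<-≤-trans p<x x≤e))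

  letters-dropFirst : ∀ ρ L i₀ {a e bs} → L i₀ ≡ (a , e) ∷ bs → ∀ p → ⟦ e ⟧t ρ ≤ p
                    → letters ρ L p ≡ letters ρ (dropFirst i₀ L) p
  letters-dropFirst ρ L i₀ {a} {e} {bs} L-i₀≡ p e≤p = tabulate-cong same
    where
    same : ∀ i → letterAt ρ (L i) p ≡ letterAt ρ (dropFirst i₀ L i) p
    same i with i Finₚ.≟ i₀
    ... | no i≢i₀ = cong (λ t → letterAt ρ t p) (sym (updateAt-minimal i i₀ L i≢i₀))
    ... | yes refl = begin
      letterAt ρ (L i) p                               ≡⟨ cong (λ t → letterAt ρ t p) L-i₀≡ ⟩
      (if does (p <? ⟦ e ⟧t ρ) then a else letterAt ρ bs p)
        ≡⟨ cong (if_then a else letterAt ρ bs p) (dec-false (p <? ⟦ e ⟧t ρ) (ℕₚ.≤⇒≯ e≤p)) ⟩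
      letterAt ρ (drop 1 ((a , e) ∷ bs)) p              ≡⟨ cong (λ t → letterAt ρ (drop 1 t) p) (sym L-i₀≡) ⟩
      letterAt ρ (drop 1 (L i)) p                       ≡⟨ cong (λ t → letterAt ρ t p) (sym (updateAt-updates i L)) ⟩
      letterAt ρ (dropFirst i L i) p                    ∎
      where open ≡-Reasoning

  word-constant : ∀ ρ L s u → (∀ i → u ≤∞ firstEnd ρ (L i)) → word ρ L s u ≡ replicate (u ∸ s) (heads L)
  word-constant ρ L s u u≤ends = trans
    (segment-cong (letters ρ L) (λ _ → heads L) s (u ∸ s)
      (λ p s≤p p<w → tabulate-cong λ i → letterAt-first ρ (L i) (u≤ends i) (window-bound s≤p p<w)))
    (segment-const (heads L) s (u ∸ s))

  word-split : ∀ ρ L {s t u} → s ≤ t → t ≤ u → word ρ L s u ≡ word ρ L s t ++ word ρ L t u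
  word-split ρ L {s} {t} {u} s≤t t≤u =
    trans (cong (segment (letters ρ L) s) (∸-split s≤t t≤u))
          (trans (segment-++ (letters ρ L) s (t ∸ s) (u ∸ t))
                 (cong (λ t' → word ρ L s t ++ segment (letters ρ L) t' (u ∸ t)) (ℕₚ.m+[n∸m]≡n s≤t)))

  word-dropFirst : ∀ ρ L i₀ {a e bs} → L i₀ ≡ (a , e) ∷ bs → ∀ s u → ⟦ e ⟧t ρ ≤ s
                 → word ρ L s u ≡ word ρ (dropFirst i₀ L) s u
  word-dropFirst ρ L i₀ L-i₀≡ s u e≤s = segment-cong _ _ s (u ∸ s)
    (λ p s≤p _ → letters-dropFirst ρ L i₀ L-i₀≡ p (ℕₚ.≤-trans e≤s s≤p))

  Accepting : Layout → Term V → Term V → Fin nStates → (V → ℕ) → Set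
  Accepting L s u q ρ = AcceptsFrom M q (word ρ L (⟦ s ⟧t ρ) (⟦ u ⟧t ρ))

  accepts-≡ : ∀ {q w w'} → w ≡ w' → AcceptsFrom M q w ⇔ AcceptsFrom M q w'
  accepts-≡ refl = ⇔.refl

  accepting-constant : ∀ ρ L s u q → (∀ i → ⟦ u ⟧t ρ ≤∞ firstEnd ρ (L i))
                     → Accepting L s u q ρ ⇔ AcceptsFrom M q (replicate (⟦ u ⟧t ρ ∸ ⟦ s ⟧t ρ) (heads L))
  accepting-constant ρ L s u q u≤ends = accepts-≡ (word-constant ρ L (⟦ s ⟧t ρ) (⟦ u ⟧t ρ) u≤ends)

  accepting-cut : ∀ ρ L i₀ {a e bs} → L i₀ ≡ (a , e) ∷ bs → ∀ s u q
                → ⟦ s ⟧t ρ ≤ ⟦ e ⟧t ρ → ⟦ e ⟧t ρ ≤ ⟦ u ⟧t ρ → (∀ j → ⟦ e ⟧t ρ ≤∞ firstEnd ρ (L j))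
                → Accepting L s u q ρ ⇔ Accepting (dropFirst i₀ L) e u (run M q (replicate (⟦ e ⟧t ρ ∸ ⟦ s ⟧t ρ) (heads L))) ρ
  accepting-cut ρ L i₀ {e = e} L-i₀≡ s u q s≤e e≤u e≤ends = ⇔.trans
    (accepts-≡ (trans (word-split ρ L s≤e e≤u)
                      (cong₂ _++_ (word-constant ρ L _ _ e≤ends) (word-dropFirst ρ L i₀ L-i₀≡ _ _ ℕₚ.≤-refl))))
    (acceptsFrom-++ M q (replicate (⟦ e ⟧t ρ ∸ ⟦ s ⟧t ρ) (heads L)) (word ρ (dropFirst i₀ L) (⟦ e ⟧t ρ) (⟦ u ⟧t ρ)))

  accepting-skip : ∀ ρ L i₀ {a e bs} → L i₀ ≡ (a , e) ∷ bs → ∀ s u q → ⟦ e ⟧t ρ ≤ ⟦ s ⟧t ρ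
                 → Accepting L s u q ρ ⇔ Accepting (dropFirst i₀ L) s u q ρ
  accepting-skip ρ L i₀ L-i₀≡ s u q e≤s = accepts-≡ (word-dropFirst ρ L i₀ L-i₀≡ _ _ e≤s)

  -- The three ways in which the word between s and u can be accepted, according to where the
  -- earliest end of a first block lies: at or after u; in [s, u] (cut there); or before s (skip it).
  Constant : Layout → Term V → Term V → Fin nStates → (V → ℕ) → Set
  Constant L s u q ρ = (∀ i → ⟦ u ⟧t ρ ≤∞ firstEnd ρ (L i)) × AcceptsFrom M q (replicate (⟦ u ⟧t ρ ∸ ⟦ s ⟧t ρ) (heads L))

  Cut : Layout → Fin m → Term V → Term V → Term V → Fin nStates → (V → ℕ) → Set
  Cut L i₀ e s u q ρ = (⟦ s ⟧t ρ ≤ ⟦ e ⟧t ρ × ⟦ e ⟧t ρ ≤ ⟦ u ⟧t ρ × ∀ j → ⟦ e ⟧t ρ ≤∞ firstEnd ρ (L j))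
                     × Accepting (dropFirst i₀ L) e u (run M q (replicate (⟦ e ⟧t ρ ∸ ⟦ s ⟧t ρ) (heads L))) ρ

  Skip : Layout → Fin m → Term V → Term V → Term V → Fin nStates → (V → ℕ) → Set
  Skip L i₀ e s u q ρ = ⟦ e ⟧t ρ ≤ ⟦ s ⟧t ρ × Accepting (dropFirst i₀ L) s u q ρ

  AtFirstEnd : Track → (Term V → (V → ℕ) → Set) → (V → ℕ) → Set
  AtFirstEnd [] R ρ = ⊥
  AtFirstEnd ((_ , e) ∷ _) R ρ = R e ρ

  Cases : Layout → Term V → Term V → Fin nStates → (V → ℕ) → Set
  Cases L s u q ρ = Constant L s u q ρ
                  ⊎ Σ (Fin m) λ i₀ → AtFirstEnd (L i₀) (λ e ρ → Cut L i₀ e s u q ρ ⊎ Skip L i₀ e s u q ρ) ρ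

  accepting-cases : ∀ L s u q ρ → Accepting L s u q ρ ⇔ Cases L s u q ρ
  accepting-cases L s u q ρ = mk⇔ cover assemble
    where
    S = ⟦ s ⟧t ρ
    U = ⟦ u ⟧t ρ
    coverAt : ∀ i₀ t → L i₀ ≡ t → ∀ v → firstEnd ρ t ≡ just v → v < U → (∀ j → v ≤∞ firstEnd ρ (L j))
            → Accepting L s u q ρ → AtFirstEnd t (λ e ρ → Cut L i₀ e s u q ρ ⊎ Skip L i₀ e s u q ρ) ρ
    coverAt i₀ ((a , e) ∷ bs) L-i₀≡ _ refl e<u e≤ends acc with S ≤? ⟦ e ⟧t ρ
    ... | yes s≤e = let e≤u = ℕₚ.<⇒≤ e<u in
      inj₁ ((s≤e , e≤u , e≤ends) , to (accepting-cut ρ L i₀ L-i₀≡ s u q s≤e e≤u e≤ends) acc)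
    ... | no s≰e = let e≤s = ℕₚ.<⇒≤ (ℕₚ.≰⇒> s≰e) in inj₂ (e≤s , to (accepting-skip ρ L i₀ L-i₀≡ s u q e≤s) acc)
    cover : Accepting L s u q ρ → Cases L s u q ρ
    cover acc with least-below U m (λ i → firstEnd ρ (L i))
    ... | inj₁ u≤ends = inj₁ (u≤ends , to (accepting-constant ρ L s u q u≤ends) acc)
    ... | inj₂ (i₀ , v , end≡v , v<u , v≤ends) = inj₂ (i₀ , coverAt i₀ (L i₀) refl v end≡v v<u v≤ends acc)
    assembleAt : ∀ i₀ t → L i₀ ≡ t → AtFirstEnd t (λ e ρ → Cut L i₀ e s u q ρ ⊎ Skip L i₀ e s u q ρ) ρ
               → Accepting L s u q ρ
    assembleAt i₀ ((a , e) ∷ bs) L-i₀≡ (inj₁ ((s≤e , e≤u , e≤ends) , acc)) =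
      from (accepting-cut ρ L i₀ L-i₀≡ s u q s≤e e≤u e≤ends) acc
    assembleAt i₀ ((a , e) ∷ bs) L-i₀≡ (inj₂ (e≤s , acc)) = from (accepting-skip ρ L i₀ L-i₀≡ s u q e≤s) acc
    assemble : Cases L s u q ρ → Accepting L s u q ρ
    assemble (inj₁ (u≤ends , acc)) = from (accepting-constant ρ L s u q u≤ends) acc
    assemble (inj₂ (i₀ , c)) = assembleAt i₀ (L i₀) refl c

  definable-≤∞ : (x : Term V) (t : Track) → Definable V (λ ρ → ⟦ x ⟧t ρ ≤∞ firstEnd ρ t)
  definable-≤∞ x [] = definable-⇔ (λ ρ → mk⇔ (λ _ → tt) (λ _ → ≤∞-∞)) definable-⊤
  definable-≤∞ x ((_ , e) ∷ _) = definable-⇔ (λ ρ → mk⇔ (λ { (≤∞-fin x≤e) → x≤e }) ≤∞-fin) (definable-≤ x e)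

  definable-run-constant : (Q : Fin nStates → Set) → (∀ r → Dec (Q r)) → ∀ q (x : Vec A m) (s u : Term V)
                         → Definable V (λ ρ → Q (run M q (replicate (⟦ u ⟧t ρ ∸ ⟦ s ⟧t ρ) x)))
  definable-run-constant Q Q? q x s u =
    definable-at-∸ u s (definable-orbit (λ n → run M q (replicate n x)) (run-replicate-deterministic M q x) Q Q? nothing)

  definable-constant : ∀ L s u q → Definable V (Constant L s u q)
  definable-constant L s u q = definable-× (definable-all m λ i → definable-≤∞ u (L i))
    (definable-run-constant (λ r → final r ≡ true) (λ r → final r Boolₚ.≟ true) q (heads L) s u)

  -- For a cut, the intermediate state is guessed among the finitely many states of M.
  definable-cut : ∀ L i₀ e s u q → (∀ q' → Definable V (Accepting (dropFirst i₀ L) e u q')) → Definable V (Cut L i₀ e s u q)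
  definable-cut L i₀ e s u q accepting-from =
    definable-× (definable-× (definable-≤ s e) (definable-× (definable-≤ e u) (definable-all m λ j → definable-≤∞ e (L j))))
                (definable-⇔ (λ ρ → one-point)
                   (definable-any nStates λ q' → definable-× (definable-run-constant (q' ≡_) (q' Finₚ.≟_) q (heads L) s e)
                                                             (accepting-from q')))

  definable-skip : ∀ L i₀ e s u q → Definable V (Accepting (dropFirst i₀ L) s u q) → Definable V (Skip L i₀ e s u q)
  definable-skip L i₀ e s u q accepting = definable-× (definable-≤ e s) accepting

  definable-atFirstEnd : (t : Track) {R : Term V → (V → ℕ) → Set}
                       → (∀ {a e bs} → t ≡ (a , e) ∷ bs → Definable V (R e)) → Definable V (AtFirstEnd t R)
  definable-atFirstEnd [] R-definable = definable-⊥
  definable-atFirstEnd ((a , e) ∷ bs) R-definable = R-definable refl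

  definable-accepting : ∀ n L → totalLength L < n → ∀ s u q → Definable V (Accepting L s u q)
  definable-accepting zero L ()
  definable-accepting (suc n) L (s≤s size≤n) s u q = definable-⇔ (accepting-cases L s u q)
    (definable-⊎ (definable-constant L s u q)
                 (definable-any m λ i₀ → definable-atFirstEnd (L i₀) λ {_} {e} L-i₀≡ →
                    let smaller = ℕₚ.<-≤-trans (totalLength-drop L i₀ L-i₀≡) size≤n in
                    definable-⊎ (definable-cut L i₀ e s u q (definable-accepting n (dropFirst i₀ L) smaller e u))
                                (definable-skip L i₀ e s u q (definable-accepting n (dropFirst i₀ L) smaller s u q))))

  blocksFrom : {k : ℕ} → Term V → Vec A k → (Fin k → V) → Track
  blocksFrom e [] ks = []
  blocksFrom e (l ∷ ls) ks = (l , e ⊕ var (ks zero)) ∷ blocksFrom (e ⊕ var (ks zero)) ls (λ j → ks (suc j))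

  endOf : {k : ℕ} → Term V → Vec A k → (Fin k → V) → Term V
  endOf e [] ks = e
  endOf e (l ∷ ls) ks = endOf (e ⊕ var (ks zero)) ls (λ j → ks (suc j))

  length-replicate-++ : (k : ℕ) (l : A) (w : List A) → length (replicate k l ++ w) ≡ k + length w
  length-replicate-++ k l w = trans (Listₚ.length-++ (replicate k l)) (cong (_+ length w) (Listₚ.length-replicate k))

  endOf-value : ∀ ρ {k} e (ls : Vec A k) ks → ⟦ endOf e ls ks ⟧t ρ ≡ ⟦ e ⟧t ρ + length (block ls (λ j → ρ (ks j)))
  endOf-value ρ e [] ks = sym (ℕₚ.+-identityʳ _)
  endOf-value ρ e (l ∷ ls) ks = begin
    ⟦ endOf (e ⊕ var (ks zero)) ls (λ j → ks (suc j)) ⟧t ρ  ≡⟨ endOf-value ρ (e ⊕ var (ks zero)) ls (λ j → ks (suc j)) ⟩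
    ⟦ e ⟧t ρ + K + length rest                                ≡⟨ ℕₚ.+-assoc (⟦ e ⟧t ρ) K (length rest) ⟩
    ⟦ e ⟧t ρ + (K + length rest)                              ≡⟨ cong (⟦ e ⟧t ρ +_) (sym (length-replicate-++ K l rest)) ⟩
    ⟦ e ⟧t ρ + length (replicate K l ++ rest)                 ∎
    where
    open ≡-Reasoning
    K = ρ (ks zero)
    rest = block ls (λ j → ρ (ks (suc j)))

  segment-blocks : ∀ ρ {k} e (ls : Vec A k) ks n → length (block ls (λ j → ρ (ks j))) ≤ n
                 → segment (letterAt ρ (blocksFrom e ls ks)) (⟦ e ⟧t ρ) n
                   ≡ block ls (λ j → ρ (ks j)) ++ replicate (n ∸ length (block ls (λ j → ρ (ks j)))) blank
  segment-blocks ρ e [] ks n _ = segment-const blank (⟦ e ⟧t ρ) n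
  segment-blocks ρ e (l ∷ ls) ks n fits = begin
    segment g S n                                              ≡⟨ cong (segment g S) (sym (ℕₚ.m+[n∸m]≡n K≤n)) ⟩
    segment g S (K + (n ∸ K))                                  ≡⟨ segment-++ g S K (n ∸ K) ⟩
    segment g S K ++ segment g (S + K) (n ∸ K)                 ≡⟨ cong₂ _++_ first-block later-blocks ⟩
    replicate K l ++ (rest ++ replicate (n ∸ K ∸ length rest) blank) ≡⟨ sym (Listₚ.++-assoc (replicate K l) rest _) ⟩
    (replicate K l ++ rest) ++ replicate (n ∸ K ∸ length rest) blank
      ≡⟨ cong (λ r → (replicate K l ++ rest) ++ replicate r blank) padding ⟩
    (replicate K l ++ rest) ++ replicate (n ∸ length (replicate K l ++ rest)) blank ∎
    where
    open ≡-Reasoning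
    S = ⟦ e ⟧t ρ
    K = ρ (ks zero)
    rest = block ls (λ j → ρ (ks (suc j)))
    later = blocksFrom (e ⊕ var (ks zero)) ls (λ j → ks (suc j))
    g = letterAt ρ (blocksFrom e (l ∷ ls) ks)
    K+rest≤n : K + length rest ≤ n
    K+rest≤n = subst (_≤ n) (length-replicate-++ K l rest) fits
    K≤n : K ≤ n
    K≤n = ℕₚ.m+n≤o⇒m≤o K K+rest≤n
    first-block : segment g S K ≡ replicate K l
    first-block = trans
      (segment-cong g (λ _ → l) S K λ p _ p<S+K → cong (if_then l else letterAt ρ later p) (dec-true (p <? S + K) p<S+K))
      (segment-const l S K)
    later-blocks : segment g (S + K) (n ∸ K) ≡ rest ++ replicate (n ∸ K ∸ length rest) blank
    later-blocks = trans
      (segment-cong g (letterAt ρ later) (S + K) (n ∸ K)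
         λ p S+K≤p _ → cong (if_then l else letterAt ρ later p) (dec-false (p <? S + K) (ℕₚ.≤⇒≯ S+K≤p)))
      (segment-blocks ρ (e ⊕ var (ks zero)) ls (λ j → ks (suc j)) (n ∸ K)
         (subst (_≤ n ∸ K) (ℕₚ.m+n∸m≡n K (length rest)) (ℕₚ.∸-monoˡ-≤ K K+rest≤n)))
    padding : n ∸ K ∸ length rest ≡ n ∸ length (replicate K l ++ rest)
    padding = trans (ℕₚ.∸-+-assoc n K (length rest)) (cong (n ∸_) (sym (length-replicate-++ K l rest)))

  column-word : ∀ ρ L i s u → map (λ v → lookup v i) (word ρ L s u) ≡ segment (letterAt ρ (L i)) s (u ∸ s)
  column-word ρ L i s u = trans (segment-map (λ v → lookup v i) (letters ρ L) s (u ∸ s))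
    (segment-cong _ _ s (u ∸ s) λ p _ _ → lookup∘tabulate (λ i' → letterAt ρ (L i') p) i)

module Encoding (d : ℕ) (0<d : 0 < d) {m : ℕ} (M : DFA (Vec (Digit d) m))
                (n : Fin m → ℕ) (ℓ : (i : Fin m) → Vec (Digit d) (n i)) where

  Var : Set
  Var = Σ (Fin m) λ i → Fin (n i)

  0ᵈ : Digit d
  0ᵈ = ℤ.0ℤ , 0<d

  val-zeros : ∀ r → val d (replicate r 0ᵈ) ≡ ℤ.0ℤ
  val-zeros zero = refl
  val-zeros (suc r) = trans (cong (λ v → ℤ.0ℤ ℤ.+ ℤ.+ d ℤ.* v) (val-zeros r))
                            (cong (λ v → ℤ.0ℤ ℤ.+ v) (ℤₚ.*-zeroʳ (ℤ.+ d)))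

  val-padding : ∀ w r → val d (w ++ replicate r 0ᵈ) ≡ val d w
  val-padding [] r = val-zeros r
  val-padding (x ∷ w) r = cong (λ v → proj₁ x ℤ.+ ℤ.+ d ℤ.* v) (val-padding w r)

  -- Besides the k_ij, the layout uses a start position s (just nothing) and an end position u (nothing).
  open Layouts 0ᵈ M (Maybe (Maybe Var))

  start : Term (Maybe (Maybe Var))
  start = var (just nothing)

  exponent : (i : Fin m) → Fin (n i) → Maybe (Maybe Var)
  exponent i j = just (just (i , j))

  layout : Layout
  layout i = blocksFrom start (ℓ i) (exponent i)

  end : Fin m → Term (Maybe (Maybe Var))
  end i = endOf start (ℓ i) (exponent i)

  target : (Var → ℕ) → Vec ℤ m
  target k = tabulate (λ i → val d (block (ℓ i) (λ j → k (i , j))))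

  word-value : ∀ k s u → (∀ i → ⟦ end i ⟧t (extend (extend k s) u) ≤ u)
             → valVec d m (word (extend (extend k s) u) layout s u) ≡ target k
  word-value k s u ends≤u = tabulate-cong λ i → begin
    val d (map (λ v → lookup v i) (word ρ layout s u))          ≡⟨ cong (val d) (column-word ρ layout i s u) ⟩
    val d (segment (letterAt ρ (layout i)) s (u ∸ s))
      ≡⟨ cong (val d) (segment-blocks ρ start (ℓ i) (exponent i) (u ∸ s) (fits i)) ⟩
    val d (block (ℓ i) (λ j → k (i , j)) ++ replicate _ 0ᵈ)     ≡⟨ val-padding (block (ℓ i) (λ j → k (i , j))) _ ⟩
    val d (block (ℓ i) (λ j → k (i , j)))                       ∎
    where
    open ≡-Reasoning
    ρ = extend (extend k s) u
    fits : ∀ i → length (block (ℓ i) (λ j → k (i , j))) ≤ u ∸ s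
    fits i = ℕₚ.m+n≤o⇒m≤o∸n _ (subst (_≤ u) (trans (endOf-value ρ start (ℓ i) (exponent i)) (ℕₚ.+-comm s _)) (ends≤u i))

  -- For some start s and some u beyond the ends of all tracks, M accepts the word between s and u.
  -- (The start is a variable only because terms have no constant 0; the word does not depend on it.)
  Encoded : (Var → ℕ) → Set
  Encoded k = Σ ℕ λ s → Σ ℕ λ u → let ρ = extend (extend k s) u in
              (∀ i → ⟦ end i ⟧t ρ ≤ u) × Accepting layout start (var nothing) (DFA.start M) ρ

  definable-encoded : Definable Var Encoded
  definable-encoded = definable-∃ (definable-∃ (definable-×
    (definable-all m λ i → definable-≤ (end i) (var nothing))
    (definable-accepting (suc (totalLength layout)) layout ℕₚ.≤-refl start (var nothing) (DFA.start M))))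

  target⇔encoded : (X : Vec ℤ m → Set) → (∀ w → X (valVec d m w) ⇔ Accepts M w) → ∀ k → X (target k) ⇔ Encoded k
  target⇔encoded X X⇔accepts k = mk⇔ encode decode
    where
    blocks : Fin m → List (Digit d)
    blocks i = block (ℓ i) (λ j → k (i , j))
    U = totalLength blocks
    encode : X (target k) → Encoded k
    encode x = 0 , U , ends≤U ,
      to (X⇔accepts (word (extend (extend k 0) U) layout 0 U)) (subst X (sym (word-value k 0 U ends≤U)) x)
      where
      ends≤U : ∀ i → ⟦ end i ⟧t (extend (extend k 0) U) ≤ U
      ends≤U i = subst (_≤ U) (sym (endOf-value _ start (ℓ i) (exponent i))) (length≤totalLength blocks i)
    decode : Encoded k → X (target k)
    decode (s , u , ends≤u , accepted) =
      subst X (word-value k s u ends≤u) (from (X⇔accepts (word (extend (extend k s) u) layout s u)) accepted)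

lemma6p10 : (d m : ℕ) → 2 ≤ d → 1 ≤ m → (X : Vec ℤ m → Set) → Automatic d m X
    → (n : Fin m → ℕ) → (ℓ : (i : Fin m) → Vec (Digit d) (n i))
    → PresburgerDefinable (Σ (Fin m) (λ i → Fin (n i)))
        (λ k → X (tabulate (λ i → val d (block (ℓ i) (λ j → k (i , j))))))
lemma6p10 d m 2≤d _ X (M , X⇔accepts) n ℓ = definable-⇔ (target⇔encoded X X⇔accepts) definable-encoded
  where open Encoding d (ℕₚ.<-≤-trans (s≤s z≤n) 2≤d) M n ℓ
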